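{- There exist two pp-interpretations $I_1,I_2$ of dimension $1$ of $(\mathbb{Q};<)$ in $\mathcal{CDC}$, and a pp-interpretation $J$ of dimension $2$ of $\mathcal{CDC}$ in $(\mathbb{Q};<)$, such that $J\circ(I_1,I_2)$ is pp-homotopic to the identity interpretation of $\mathcal{CDC}$.
   Context: $\mathcal{CDC}$ (the cardinal direction calculus) is the structure with domain $\mathbb{Q}^2$ and the eight binary relations, for $p=(x,y)$ and $p'=(x',y')$: $p\,\mathtt{N}\,p'$ iff $y>y'\wedge x=x'$; $p\,\mathtt{E}\,p'$ iff $x>x'\wedge y=y'$; $p\,\mathtt{S}\,p'$ iff $y'>y\wedge x=x'$; $p\,\mathtt{W}\,p'$ iff $x'>x\wedge y=y'$; $p\,\mathtt{NE}\,p'$ iff $y>y'\wedge x>x'$; $p\,\mathtt{SE}\,p'$ iff $y'>y\wedge x>x'$; $p\,\mathtt{SW}\,p'$ iff $y'>y\wedge x'>x$; $p\,\mathtt{NW}\,p'$ iff $y>y'\wedge x'>x$. A primitive positive (pp) formula uses only atomic formulas (relations and equality), conjunction and existential quantification; definability is parameter-free. A pp-interpretation of $\mathcal{B}$ in $\mathcal{A}$ is a triple $(k,\delta,g)$ with $\delta\subseteq A^k$ pp-definable in $\mathcal{A}$, $g:\delta\to B$ surjective, such that for every $s$-ary relation $S$ of $\mathcal{B}$ and for equality on $B$, $\{(\bar a_1,\ldots,\bar a_s)\in\delta^s:(g(\bar a_1),\ldots,g(\bar a_s))\in S\}$ is pp-definable in $\mathcal{A}$. For $I_\ell=(i,\delta_\ell,g_\ell)$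 interpreting $\mathcal{D}$ in $\mathcal{C}$ and $J=(j,\epsilon,h)$ interpreting $\mathcal{C}$ in $\mathcal{D}$, $J\circ(I_1,\ldots,I_j)$ is the partial map $F:C^{ij}\rightharpoonup C$, $F(x_1,\ldots,x_{ij})=h(g_1(x_1,\ldots,x_i),\ldots,g_j(x_{ij-i+1},\ldots,x_{ij}))$, defined when each block lies in $\delta_\ell$ and the image tuple lies in $\epsilon$; it is pp-homotopic to the identity interpretation $(1,C,\mathrm{id})$ of $\mathcal{C}$ if $\{(y,x_1,\ldots,x_{ij}):F(x_1,\ldots,x_{ij})=y\}$ is pp-definable in $\mathcal{C}$. -}

module Defs where

open import Data.Nat using (ℕ; suc; _*_)
open import Data.Fin using (Fin; zero; suc; combine)
open import Data.Product using (Σ; ∃; _×_; _,_)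
open import Data.Unit using (⊤; tt)
open import Data.Rational using (ℚ; _<_)
open import Function.Bundles using (_⇔_)
open import Relation.Binary.PropositionalEquality using (_≡_)

record Structure : Set₁ where
  field
    Carrier : Set
    Sym     : Set
    ar      : Sym → ℕ
    rel     : (s : Sym) → (Fin (ar s) → Carrier) → Set
open Structure public

-- Primitive positive formulas over the signature of 𝔄, with n free variables
-- (de Bruijn: variable zero is the most recently bound one under ∃').
data PP (𝔄 : Structure) (n : ℕ) : Set where
  atom : (s : Sym 𝔄) → (Fin (ar 𝔄 s) → Fin n) → PP 𝔄 n
  equ  : Fin n → Fin n → PP 𝔄 n
  _∧_  : PP 𝔄 n → PP 𝔄 n → PP 𝔄 n
  ∃'   : PP 𝔄 (suc n) → PP 𝔄 n

⟦_⟧ : ∀ {𝔄 n} → PP 𝔄 n → (Fin n → Carrier 𝔄) → Set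
⟦_⟧ {𝔄} (atom s args) v = rel 𝔄 s (λ i → v (args i))
⟦ equ i j ⟧ v = v i ≡ v j
⟦ φ ∧ ψ ⟧ v = ⟦ φ ⟧ v × ⟦ ψ ⟧ v
⟦_⟧ {𝔄} (∃' φ) v = Σ (Carrier 𝔄) λ a → ⟦ φ ⟧ (λ { zero → a ; (suc i) → v i })

PPDefinable : (𝔄 : Structure) (n : ℕ) → ((Fin n → Carrier 𝔄) → Set) → Set
PPDefinable 𝔄 n R = Σ (PP 𝔄 n) λ φ → ∀ v → R v ⇔ ⟦ φ ⟧ v

block : ∀ {A : Set} (s k : ℕ) → (Fin (s * k) → A) → Fin s → Fin k → A
block s k v i j = v (combine i j)

-- A pp-interpretation of 𝔅 in 𝔄 of dimension k.  The map g is given as a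
-- total function on A^k, but only its restriction to δ is ever used.
record Interp (𝔄 𝔅 : Structure) (k : ℕ) : Set₁ where
  field
    δ      : (Fin k → Carrier 𝔄) → Set
    δ-def  : PPDefinable 𝔄 k δ
    g      : (Fin k → Carrier 𝔄) → Carrier 𝔅
    g-surj : ∀ b → Σ (Fin k → Carrier 𝔄) λ a → δ a × g a ≡ b
    rel-def : ∀ (S : Sym 𝔅) → PPDefinable 𝔄 (ar 𝔅 S * k)
      (λ v → (∀ i → δ (block (ar 𝔅 S) k v i))
             × rel 𝔅 S (λ i → g (block (ar 𝔅 S) k v i)))
    eq-def : PPDefinable 𝔄 (2 * k)
      (λ v → (∀ i → δ (block 2 k v i))
             × g (block 2 k v zero) ≡ g (block 2 k v (suc zero)))
open Interp public

-- J ∘ (I_1,…,I_j) is pp-homotopic to the identity interpretation of ℭ: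
-- the graph {(y,x_1,…,x_{ij}) : F(x_1,…,x_{ij}) = y} (F defined) is pp-definable in ℭ.
PPHomotopicToId : ∀ {ℭ 𝔇 : Structure} {i j : ℕ}
  → Interp 𝔇 ℭ j → (Fin j → Interp ℭ 𝔇 i) → Set
PPHomotopicToId {ℭ} {𝔇} {i} {j} J Is =
  PPDefinable ℭ (suc (j * i)) λ w →
    let xs = λ (p : Fin (j * i)) → w (suc p)
        ys = λ (l : Fin j) → g (Is l) (block j i xs l)
    in (∀ l → δ (Is l) (block j i xs l)) × δ J ys × g J ys ≡ w zero

QLt : Structure
QLt = record { Carrier = ℚ ; Sym = ⊤ ; ar = λ _ → 2
             ; rel = λ _ v → v zero < v (suc zero) }

data Dir : Set where
  N E S W NE SE SW NW : Dir

cdcRel : Dir → ℚ × ℚ → ℚ × ℚ → Set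
cdcRel N  (x , y) (x' , y') = y' < y × x ≡ x'
cdcRel E  (x , y) (x' , y') = x' < x × y ≡ y'
cdcRel S  (x , y) (x' , y') = y < y' × x ≡ x'
cdcRel W  (x , y) (x' , y') = x < x' × y ≡ y'
cdcRel NE (x , y) (x' , y') = y' < y × x' < x
cdcRel SE (x , y) (x' , y') = y < y' × x' < x
cdcRel SW (x , y) (x' , y') = y < y' × x < x'
cdcRel NW (x , y) (x' , y') = y' < y × x < x'

CDC : Structure
CDC = record { Carrier = ℚ × ℚ ; Sym = Dir ; ar = λ _ → 2
             ; rel = λ d v → cdcRel d (v zero) (v (suc zero)) }

-- A point p is recovered from its two coordinates, and each coordinate order of (ℚ; <)
-- is pp-definable in CDC: x p = x q iff some point lies due north of both, and
-- x p < x q iff some point lies due north of p and north-west of q (the witness is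
-- placed high enough using that ℚ is unbounded).  Symmetrically for y with E and SE.
-- So projecting onto x resp. y gives I₁, I₂, pairing gives J, and the graph of
-- p ↦ (x p₁ , y p₂) is defined by "p, p₁ share x and p, p₂ share y".
module Submission where

open import Defs
open import Data.Nat using (suc; _*_)
open import Data.Product using (Σ; _×_; _,_; proj₁; proj₂)
open import Data.Product.Properties using (×-≡,≡→≡; ×-≡,≡←≡)
open import Data.Vec.Functional using (_∷_; [])
open import Data.Fin using (Fin; zero; suc)
open import Data.Unit using (⊤; tt)
open import Data.Rational using (ℚ; _<_; _+_; _⊔_; 0ℚ; 1ℚ)
open import Data.Rational.Properties
  using (≤-<-trans; +-monoʳ-<; +-identityʳ; p≤p⊔q; p≤q⊔p; positive⁻¹)
open import Function.Bundles using (_⇔_; mk⇔; Equivalence)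
open import Function.Construct.Identity using (⇔-id)
open import Function.Construct.Composition using (_⇔-∘_)
open import Relation.Binary.PropositionalEquality using (_≡_; refl; sym; trans; subst)

p<p+1 : ∀ p → p < p + 1ℚ
p<p+1 p = subst (_< p + 1ℚ) (+-identityʳ p) (+-monoʳ-< p (positive⁻¹ 1ℚ))

common-upper-bound : ∀ p q → Σ ℚ λ r → p < r × q < r
common-upper-bound p q =
  p ⊔ q + 1ℚ , ≤-<-trans (p≤p⊔q p q) (p<p+1 _) , ≤-<-trans (p≤q⊔p p q) (p<p+1 _)

totalInterp : ∀ {𝔄 𝔅 k} (g : (Fin (suc k) → Carrier 𝔄) → Carrier 𝔅) →
  (∀ b → Σ (Fin (suc k) → Carrier 𝔄) λ a → g a ≡ b) →
  (∀ S → PPDefinable 𝔄 (ar 𝔅 S * suc k) λ v →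
           rel 𝔅 S (λ i → g (block (ar 𝔅 S) (suc k) v i))) →
  PPDefinable 𝔄 (2 * suc k)
    (λ v → g (block 2 (suc k) v zero) ≡ g (block 2 (suc k) v (suc zero))) →
  Interp 𝔄 𝔅 (suc k)
totalInterp {𝔄} g g-surj rel-def eq-def = record
  { δ       = λ _ → ⊤
  ; δ-def   = equ zero zero , λ _ → mk⇔ (λ _ → refl) (λ _ → tt)
  ; g       = g
  ; g-surj  = λ b → let (a , ga≡b) = g-surj b in a , tt , ga≡b
  ; rel-def = λ S → guarded (rel-def S)
  ; eq-def  = guarded eq-def
  }
  where
  guarded : ∀ {m n R} → PPDefinable 𝔄 n R → PPDefinable 𝔄 n λ v → (Fin m → ⊤) × R v
  guarded (φ , R⇔φ) = φ , λ v → R⇔φ v ⇔-∘ mk⇔ proj₂ (λ r → (λ _ → tt) , r)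

witnessed : ∀ {n} → Dir → Dir → Fin n → Fin n → PP CDC n
witnessed d d' i j = ∃' (atom d (zero ∷ suc i ∷ []) ∧ atom d' (zero ∷ suc j ∷ []))

module _ {n} (v : Fin n → ℚ × ℚ) (i j : Fin n) where
  private
    xᵢ = proj₁ (v i); yᵢ = proj₂ (v i)
    xⱼ = proj₁ (v j); yⱼ = proj₂ (v j)

  x-≡-witnessed : xᵢ ≡ xⱼ ⇔ ⟦ witnessed N N i j ⟧ v
  x-≡-witnessed = mk⇔
    (λ xᵢ≡xⱼ → let (r , yᵢ<r , yⱼ<r) = common-upper-bound yᵢ yⱼ
               in (xᵢ , r) , (yᵢ<r , refl) , (yⱼ<r , xᵢ≡xⱼ))
    (λ { (_ , (_ , z≡xᵢ) , (_ , z≡xⱼ)) → trans (sym z≡xᵢ) z≡xⱼ })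

  x-<-witnessed : xᵢ < xⱼ ⇔ ⟦ witnessed N NW i j ⟧ v
  x-<-witnessed = mk⇔
    (λ xᵢ<xⱼ → let (r , yᵢ<r , yⱼ<r) = common-upper-bound yᵢ yⱼ
               in (xᵢ , r) , (yᵢ<r , refl) , (yⱼ<r , xᵢ<xⱼ))
    (λ { (_ , (_ , z≡xᵢ) , (_ , z<xⱼ)) → subst (_< xⱼ) z≡xᵢ z<xⱼ })

  y-≡-witnessed : yᵢ ≡ yⱼ ⇔ ⟦ witnessed E E i j ⟧ v
  y-≡-witnessed = mk⇔
    (λ yᵢ≡yⱼ → let (r , xᵢ<r , xⱼ<r) = common-upper-bound xᵢ xⱼ
               in (r , yᵢ) , (xᵢ<r , refl) , (xⱼ<r , yᵢ≡yⱼ))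
    (λ { (_ , (_ , z≡yᵢ) , (_ , z≡yⱼ)) → trans (sym z≡yᵢ) z≡yⱼ })

  y-<-witnessed : yᵢ < yⱼ ⇔ ⟦ witnessed E SE i j ⟧ v
  y-<-witnessed = mk⇔
    (λ yᵢ<yⱼ → let (r , xᵢ<r , xⱼ<r) = common-upper-bound xᵢ xⱼ
               in (r , yᵢ) , (xᵢ<r , refl) , (yᵢ<yⱼ , xⱼ<r))
    (λ { (_ , (_ , z≡yᵢ) , (z<yⱼ , _)) → subst (_< yⱼ) z≡yᵢ z<yⱼ })

x-interp : Interp CDC QLt 1
x-interp = totalInterp (λ a → proj₁ (a zero)) (λ x → (λ _ → x , 0ℚ) , refl)
  (λ _ → witnessed N NW zero (suc zero) , λ v → x-<-witnessed v zero (suc zero))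
  (witnessed N N zero (suc zero) , λ v → x-≡-witnessed v zero (suc zero))

y-interp : Interp CDC QLt 1
y-interp = totalInterp (λ a → proj₂ (a zero)) (λ y → (λ _ → 0ℚ , y) , refl)
  (λ _ → witnessed E SE zero (suc zero) , λ v → y-<-witnessed v zero (suc zero))
  (witnessed E E zero (suc zero) , λ v → y-≡-witnessed v zero (suc zero))

cdcRel-formula : Dir → PP QLt 4
cdcRel-formula = formula
  where
  x₁ x₂ y₁ y₂ : Fin 4
  x₁ = zero; y₁ = suc zero; x₂ = suc (suc zero); y₂ = suc (suc (suc zero))
  infix 30 _≺_
  _≺_ : Fin 4 → Fin 4 → PP QLt 4
  a ≺ b = atom tt (a ∷ b ∷ [])
  formula : Dir → PP QLt 4
  formula N  = y₂ ≺ y₁ ∧ equ x₁ x₂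
  formula E  = x₂ ≺ x₁ ∧ equ y₁ y₂
  formula S  = y₁ ≺ y₂ ∧ equ x₁ x₂
  formula W  = x₁ ≺ x₂ ∧ equ y₁ y₂
  formula NE = y₂ ≺ y₁ ∧ x₂ ≺ x₁
  formula SE = y₁ ≺ y₂ ∧ x₂ ≺ x₁
  formula SW = y₁ ≺ y₂ ∧ x₁ ≺ x₂
  formula NW = y₂ ≺ y₁ ∧ x₁ ≺ x₂

cdcRel-definable : ∀ d → PPDefinable QLt 4 λ v →
  cdcRel d (v zero , v (suc zero)) (v (suc (suc zero)) , v (suc (suc (suc zero))))
cdcRel-definable d = cdcRel-formula d , λ v → by-cases d v
  where
  by-cases : ∀ d v →
    cdcRel d (v zero , v (suc zero)) (v (suc (suc zero)) , v (suc (suc (suc zero))))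
      ⇔ ⟦ cdcRel-formula d ⟧ v
  by-cases N  v = ⇔-id _
  by-cases E  v = ⇔-id _
  by-cases S  v = ⇔-id _
  by-cases W  v = ⇔-id _
  by-cases NE v = ⇔-id _
  by-cases SE v = ⇔-id _
  by-cases SW v = ⇔-id _
  by-cases NW v = ⇔-id _

pairing-interp : Interp QLt CDC 2
pairing-interp = totalInterp (λ a → a zero , a (suc zero)) (λ (x , y) → (x ∷ y ∷ []) , refl)
  cdcRel-definable
  ( equ zero (suc (suc zero)) ∧ equ (suc zero) (suc (suc (suc zero)))
  , λ v → mk⇔ ×-≡,≡←≡ ×-≡,≡→≡ )

lemma7 : Σ (Interp CDC QLt 1) λ I₁ → Σ (Interp CDC QLt 1) λ I₂ →
    Σ (Interp QLt CDC 2) λ J → PPHomotopicToId J (I₁ ∷ I₂ ∷ [])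
lemma7 = x-interp , y-interp , pairing-interp , graph , λ w → mk⇔
    (λ (_ , _ , F≡p) → let (x≡ , y≡) = ×-≡,≡←≡ (sym F≡p) in
      to (x-≡-witnessed w p p₁) x≡ , to (y-≡-witnessed w p p₂) y≡)
    (λ (x-def , y-def) → (λ { zero → tt ; (suc zero) → tt }) , tt ,
      sym (×-≡,≡→≡ (from (x-≡-witnessed w p p₁) x-def , from (y-≡-witnessed w p p₂) y-def)))
  where
  open Equivalence
  p p₁ p₂ : Fin 3
  p = zero; p₁ = suc zero; p₂ = suc (suc zero)
  graph : PP CDC 3
  graph = witnessed N N p p₁ ∧ witnessed E E p p₂
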